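{- Let $k$ be a positive integer with $k\equiv 1 \pmod 5$. Then $va_3^{\equiv}(K_{4k,4k,4k})\geq \frac{12k+3}{5}$.
   Context: All graphs are finite and simple. A $t$-coloring of a graph $G$ is a map $f:V(G)\to\{1,\dots,t\}$, with color classes $V_i=\{v: f(v)=i\}$. It is equitable if $\big||V_i|-|V_j|\big|\le 1$ for all $i,j$. A $(t,k)$-tree-coloring of $G$ is a $t$-coloring such that every connected component of each induced subgraph $G[V_i]$ is a tree of maximum degree at most $k$; an equitable $(t,k)$-tree-coloring is a $(t,k)$-tree-coloring that is equitable. The strong equitable vertex $k$-arboricity $va_k^{\equiv}(G)$ is the smallest integer $t$ such that $G$ has an equitable $(t',k)$-tree-coloring for every integer $t'\ge t$. $K_{n,n,n}$ denotes the complete tripartite graph whose three partite sets each have exactly $n$ vertices. -}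

module Defs where

open import Data.Nat using (ℕ; zero; suc; _+_; _*_; _≤_; _≥_)
open import Data.Bool using (Bool; true; false; not; _∧_)
open import Data.Fin using (Fin; zero; suc; inject₁; fromℕ; quotient; _≟_)
open import Data.List using (List; length; filter; allFin)
open import Data.Product using (Σ; _×_; ∃)
open import Function.Definitions using (Injective)
open import Relation.Binary.PropositionalEquality using (_≡_; _≢_)
open import Relation.Nullary using (¬_; does)

record Graph : Set where
  field
    n     : ℕ
    adj   : Fin n → Fin n → Bool
    sym   : ∀ u v → adj u v ≡ adj v u
    irrefl : ∀ v → adj v v ≡ false
open Graph public

-- Complete tripartite graph K_{m,m,m}: vertices Fin (3 * m), vertex v lies in
-- partite set  quotient m v : Fin 3 ; two vertices are adjacent iff they lie
-- in different partite sets.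
module _ (m : ℕ) where
  part : Fin (3 * m) → Fin 3
  part = quotient {3} m

  K-adj : Fin (3 * m) → Fin (3 * m) → Bool
  K-adj u v = not (does (part u ≟ part v))

  K-sym : ∀ u v → K-adj u v ≡ K-adj v u
  K-sym u v with part u ≟ part v | part v ≟ part u
  ... | Relation.Nullary.yes _ | Relation.Nullary.yes _ = Relation.Binary.PropositionalEquality.refl
  ... | Relation.Nullary.no _  | Relation.Nullary.no _  = Relation.Binary.PropositionalEquality.refl
  ... | Relation.Nullary.yes p | Relation.Nullary.no q  = Data.Empty.⊥-elim (q (Relation.Binary.PropositionalEquality.sym p))
    where import Data.Empty
  ... | Relation.Nullary.no p  | Relation.Nullary.yes q = Data.Empty.⊥-elim (p (Relation.Binary.PropositionalEquality.sym q))
    where import Data.Empty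

  K-irrefl : ∀ v → K-adj v v ≡ false
  K-irrefl v with part v ≟ part v
  ... | Relation.Nullary.yes _ = Relation.Binary.PropositionalEquality.refl
  ... | Relation.Nullary.no ¬p = Data.Empty.⊥-elim (¬p Relation.Binary.PropositionalEquality.refl)
    where import Data.Empty

K3 : ℕ → Graph
K3 m = record { n = 3 * m ; adj = K-adj m ; sym = K-sym m ; irrefl = K-irrefl m }

module _ (G : Graph) {t : ℕ} (f : Fin (n G) → Fin t) where
  class : Fin t → List (Fin (n G))
  class i = filter (λ v → f v ≟ i) (allFin (n G))

  classSize : Fin t → ℕ
  classSize i = length (class i)

  classDeg : Fin (n G) → ℕ
  classDeg v = length (filter (λ u → adj G v u Data.Bool.≟ true) (class (f v)))
    where import Data.Bool

  -- a cycle (of length suc l ≥ 3) of G lying inside the colour class V_i: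
  -- distinct vertices c 0, …, c l with c j ~ c (j+1) and c l ~ c 0.
  record MonoCycle (i : Fin t) : Set where
    field
      l        : ℕ
      long     : l ≥ 2
      c        : Fin (suc l) → Fin (n G)
      distinct : Injective _≡_ _≡_ c
      inClass  : ∀ j → f (c j) ≡ i
      step     : ∀ (j : Fin l) → adj G (c (inject₁ j)) (c (suc j)) ≡ true
      close    : adj G (c (fromℕ l)) (c zero) ≡ true

  -- every component of G[V_i] is a tree (i.e. G[V_i] has no cycle)
  -- of maximum degree at most k
  IsTreeColoring : ℕ → Set
  IsTreeColoring k = (∀ i → ¬ MonoCycle i) × (∀ v → classDeg v ≤ k)

  IsEquitable : Set
  IsEquitable = ∀ i j → classSize i ≤ classSize j + 1

HasEqTreeColoring : Graph → ℕ → ℕ → Set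
HasEqTreeColoring G t k =
  Σ (Fin (n G) → Fin t) λ f → IsTreeColoring G f k × IsEquitable G f

AllAbove : Graph → ℕ → ℕ → Set
AllAbove G k t = ∀ t' → t' ≥ t → HasEqTreeColoring G t' k

IsStrongEqVertexArboricity : Graph → ℕ → ℕ → Set
IsStrongEqVertexArboricity G k t = AllAbove G k t × (∀ s → AllAbove G k s → t ≤ s)

-- Put m = 4k and T = (12k - 2)/5, so that 3m = 5T + 2 and m ≡ 4 (mod 5); it suffices that
-- K_{m,m,m} has no equitable (T,3)-tree-coloring.  Since 3m = 5T + 2, equitability forces every
-- colour class to have at least 5 vertices.  A class containing vertices u, v of different parts
-- has at most 4: its members outside the part of u are neighbours of u, those inside are
-- neighbours of v, so each group has at most 3 members, and two members in each group would span
-- a monochromatic 4-cycle.  So every class lies within one partite set, and m, the size of part 0,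
-- is a sum of class sizes.  Writing the class sizes as 5 + e_i with Σ e_i = 2, this makes m
-- congruent mod 5 to a number at most 2, contradicting m ≡ 4.

module Submission where

open import Defs hiding (sym)
open import Data.Nat using (ℕ; zero; suc; _+_; _*_; _≤_; _<_; _%_; _≤?_; NonZero; z≤n; s≤s)
open import Data.Nat.Properties
  using ( +-0-commutativeMonoid; +-assoc; +-suc; +-comm; +-mono-≤; +-monoʳ-≤; +-mono-<-≤
        ; +-cancelˡ-≤; ≤-trans; ≤-reflexive; <⇒≱; ≰⇒>; m≤m+n; ≮⇒≥; m≤n⇒∃[o]m+o≡n; *-cancelˡ-<
        ; ≤-pred; module ≤-Reasoning)
open import Data.Nat.DivMod using (_/_; [m+kn]%n≡m%n; m%n≤m; m≡m%n+[m/n]*n)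
open import Data.Nat.Tactic.RingSolver using (solve-∀)
open import Algebra.Properties.CommutativeMonoid.Sum +-0-commutativeMonoid
  using (sum-syntax; sum-cong-≗; sum-remove; sum-replicate-zero; ∑-distrib-+)
open import Data.Bool using (true; if_then_else_)
import Data.Bool as Bool
open import Data.Fin using (Fin; zero; suc; _≟_; _↑ˡ_; _↑ʳ_)
open import Data.Vec.Functional using (removeAt)
open import Data.Fin.Properties using (splitAt-↑ˡ; splitAt-↑ʳ)
open import Data.List using (List; []; _∷_; length; filter; allFin; tabulate)
open import Data.List.Properties using (filter-accept; filter-reject; filter-all; filter-none; length-tabulate)
open import Data.List.Membership.Propositional using (_∈_; find)
open import Data.List.Membership.Propositional.Properties using (∈-filter⁻)
open import Data.List.Relation.Unary.Any using (here; there; any?)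
open import Data.List.Relation.Unary.All using (universal-U; _∷_)
import Data.List.Relation.Unary.All as All
open import Data.List.Relation.Unary.All.Properties using (¬Any⇒All¬; tabulate⁺)
open import Data.List.Relation.Unary.AllPairs using (_∷_)
open import Data.List.Relation.Unary.Unique.Propositional using (Unique)
import Data.List.Relation.Unary.Unique.Propositional.Properties as Unique
open import Data.List.Relation.Binary.Sublist.Propositional using (⊆-refl)
open import Data.List.Relation.Binary.Sublist.Propositional.Properties using (filter⁺; length-mono-≤)
open import Data.Vec using (Vec; []; _∷_)
import Data.Vec as Vec
import Data.Vec.Relation.Unary.All as VecAll
import Data.Vec.Relation.Unary.AllPairs as VecPairs
import Data.Vec.Relation.Unary.Unique.Propositional as VecUnique
import Data.Vec.Relation.Unary.Unique.Propositional.Properties as VecUnique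
open import Data.Product using (∃₂; _×_; _,_; proj₁; proj₂)
open import Data.Sum using (_⊎_; inj₁; inj₂)
open import Data.Empty using (⊥-elim)
open import Function using (_∘_)
open import Relation.Nullary using (¬_; ¬?; yes; no; does)
open import Relation.Nullary.Decidable using (decidable-stable)
open import Relation.Unary using (Pred; Decidable)
open import Relation.Unary.Properties using (U?)
open import Relation.Binary.PropositionalEquality
  using (_≡_; _≢_; refl; sym; trans; cong; cong₂; subst; module ≡-Reasoning)

∑-indicator : ∀ {T} (x : Fin T) → ∑[ i < T ] (if does (x ≟ i) then 1 else 0) ≡ 1
∑-indicator {suc T} zero = cong suc (sum-replicate-zero T)
∑-indicator (suc x) = ∑-indicator x

module _ {a p} {A : Set a} {P : Pred A p} (P? : Decidable P) where

  ∑-length-filter-fibres : ∀ {T} (f : A → Fin T) xs →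
    ∑[ i < T ] length (filter P? (filter (λ x → f x ≟ i) xs)) ≡ length (filter P? xs)
  ∑-length-filter-fibres {T} f [] = sum-replicate-zero T
  ∑-length-filter-fibres {T} f (x ∷ xs) with P? x
  ... | no ¬px = begin
    ∑[ i < T ] length (filter P? (filter (λ y → f y ≟ i) (x ∷ xs))) ≡⟨ sum-cong-≗ fibre-without-x ⟩
    ∑[ i < T ] length (filter P? (filter (λ y → f y ≟ i) xs))       ≡⟨ ∑-length-filter-fibres f xs ⟩
    length (filter P? xs)                                          ∎
    where
    open ≡-Reasoning
    fibre-without-x : ∀ i → length (filter P? (filter (λ y → f y ≟ i) (x ∷ xs)))
                          ≡ length (filter P? (filter (λ y → f y ≟ i) xs))
    fibre-without-x i with f x ≟ i
    ... | yes _ = cong length (filter-reject P? ¬px)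
    ... | no _  = refl
  ... | yes px = begin
    ∑[ i < T ] length (filter P? (filter (λ y → f y ≟ i) (x ∷ xs)))   ≡⟨ sum-cong-≗ fibre-with-x ⟩
    ∑[ i < T ] ((if does (f x ≟ i) then 1 else 0)
                 + length (filter P? (filter (λ y → f y ≟ i) xs)))  ≡⟨ ∑-distrib-+ {T} _ _ ⟩
    ∑[ i < T ] (if does (f x ≟ i) then 1 else 0)
      + ∑[ i < T ] length (filter P? (filter (λ y → f y ≟ i) xs))
        ≡⟨ cong₂ _+_ (∑-indicator (f x)) (∑-length-filter-fibres f xs) ⟩
    suc (length (filter P? xs))                                      ∎
    where
    open ≡-Reasoning
    fibre-with-x : ∀ i → length (filter P? (filter (λ y → f y ≟ i) (x ∷ xs)))
                       ≡ (if does (f x ≟ i) then 1 else 0) + length (filter P? (filter (λ y → f y ≟ i) xs))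
    fibre-with-x i with f x ≟ i
    ... | yes _ = cong length (filter-accept P? px)
    ... | no _  = refl

  length-filter+length-filter-¬ : ∀ xs → length (filter P? xs) + length (filter (¬? ∘ P?) xs) ≡ length xs
  length-filter+length-filter-¬ [] = refl
  length-filter+length-filter-¬ (x ∷ xs) with P? x
  ... | yes _ = cong suc (length-filter+length-filter-¬ xs)
  ... | no _  = trans (+-suc _ _) (cong suc (length-filter+length-filter-¬ xs))

  length-filter-none-or-all : ∀ xs → (∀ {x y} → x ∈ xs → y ∈ xs → P x → P y) →
    length (filter P? xs) ≡ 0 ⊎ length (filter P? xs) ≡ length xs
  length-filter-none-or-all xs homogeneous with any? P? xs
  ... | yes some = let (x , x∈xs , px) = find some in
    inj₂ (cong length (filter-all P? (All.tabulate (λ y∈xs → homogeneous x∈xs y∈xs px))))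
  ... | no none  = inj₁ (cong length (filter-none P? (¬Any⇒All¬ xs none)))

  length-filter-tabulate-prefix : ∀ m n (g : Fin (m + n) → A) →
    (∀ i → P (g (i ↑ˡ n))) → (∀ j → ¬ P (g (m ↑ʳ j))) → length (filter P? (tabulate g)) ≡ m
  length-filter-tabulate-prefix zero n g _ reject =
    cong length (filter-none P? (tabulate⁺ reject))
  length-filter-tabulate-prefix (suc m) n g accept reject =
    trans (cong length (filter-accept P? (accept zero)))
          (cong suc (length-filter-tabulate-prefix m n (g ∘ suc) (accept ∘ suc) reject))

distinct-pair : ∀ {a} {A : Set a} {xs : List A} → Unique xs → 2 ≤ length xs →
  ∃₂ λ x y → x ≢ y × x ∈ xs × y ∈ xs
distinct-pair {xs = x ∷ y ∷ _} ((x≢y ∷ _) ∷ _) _ = x , y , x≢y , here refl , there (here refl)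
distinct-pair {xs = _ ∷ []} _ (s≤s ())

-- 3 * m unfolds to m + 2 * m, and part 0 consists of the first m vertices.
part-↑ˡ : ∀ m (i : Fin m) → part m (i ↑ˡ (2 * m)) ≡ zero
part-↑ˡ m i rewrite splitAt-↑ˡ m i (2 * m) = refl

part-↑ʳ : ∀ m (j : Fin (2 * m)) → part m (m ↑ʳ j) ≢ zero
part-↑ʳ m j rewrite splitAt-↑ʳ m (2 * m) j = λ ()

length-part₀ : ∀ m → length (filter (λ v → part m v ≟ zero) (allFin (3 * m))) ≡ m
length-part₀ m =
  length-filter-tabulate-prefix (λ v → part m v ≟ zero) m (2 * m) (λ v → v) (part-↑ˡ m) (part-↑ʳ m)

∑-bounded : ∀ {T} (g : Fin T → ℕ) {b} → (∀ i → g i ≤ b) → ∑[ i < T ] g i ≤ T * b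
∑-bounded {zero}  g bound = z≤n
∑-bounded {suc T} g bound = +-mono-≤ (bound zero) (∑-bounded (g ∘ suc) (bound ∘ suc))

equitable⇒≥ : ∀ {T} d (s : Fin T → ℕ) → (∀ i j → s i ≤ s j + 1) → T * d ≤ ∑[ i < T ] s i →
  ∀ j → d ≤ s j
equitable⇒≥ {suc T} d s equitable bound j = ≮⇒≥ λ sⱼ<d → <⇒≱ (∑s<Td sⱼ<d) bound
  where
  open ≤-Reasoning
  ∑s<Td : s j < d → ∑[ i < suc T ] s i < suc T * d
  ∑s<Td sⱼ<d = begin-strict
    ∑[ i < suc T ] s i                  ≡⟨ sum-remove {i = j} s ⟩
    s j + ∑[ i < T ] removeAt s j i     <⟨ +-mono-<-≤ sⱼ<d (∑-bounded (removeAt s j) (λ i → others-≤ _)) ⟩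
    d + T * d                           ∎
    where
    others-≤ : ∀ i → s i ≤ d
    others-≤ i = ≤-trans (equitable i j) (≤-trans (≤-reflexive (+-comm (s j) 1)) sⱼ<d)

∑-all-or-nothing : ∀ {T} d (s c : Fin T → ℕ) → (∀ i → d ≤ s i) → (∀ i → c i ≡ 0 ⊎ c i ≡ s i) →
  ∃₂ λ q e → ∑[ i < T ] c i ≡ e + q * d × T * d + e ≤ ∑[ i < T ] s i
∑-all-or-nothing {zero} d s c _ _ = 0 , 0 , refl , z≤n
∑-all-or-nothing {suc T} d s c large choice
  with q , e , ∑c≡ , Td+e≤∑s ← ∑-all-or-nothing d (s ∘ suc) (c ∘ suc) (large ∘ suc) (choice ∘ suc)
     | o , d+o≡s₀ ← m≤n⇒∃[o]m+o≡n (large zero)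
     | choice zero
... | inj₁ c₀≡0 = q , e , cong₂ _+_ c₀≡0 ∑c≡ , (begin
  suc T * d + e                      ≡⟨ +-assoc d (T * d) e ⟩
  d + (T * d + e)                    ≤⟨ +-mono-≤ (large zero) Td+e≤∑s ⟩
  s zero + ∑[ i < T ] s (suc i)      ∎)
  where open ≤-Reasoning
... | inj₂ c₀≡s₀ = suc q , e + o , (begin-equality
  c zero + ∑[ i < T ] c (suc i)      ≡⟨ cong₂ _+_ (trans c₀≡s₀ (sym d+o≡s₀)) ∑c≡ ⟩
  d + o + (e + q * d)                ≡⟨ regroup₁ d o e q ⟩
  e + o + suc q * d                  ∎) , (begin
  suc T * d + (e + o)                ≡⟨ regroup₂ T d e o ⟩
  d + o + (T * d + e)                ≤⟨ +-mono-≤ (≤-reflexive d+o≡s₀) Td+e≤∑s ⟩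
  s zero + ∑[ i < T ] s (suc i)      ∎)
  where
  open ≤-Reasoning
  regroup₁ : ∀ d o e q → d + o + (e + q * d) ≡ e + o + suc q * d
  regroup₁ = solve-∀
  regroup₂ : ∀ T d e o → suc T * d + (e + o) ≡ d + o + (T * d + e)
  regroup₂ = solve-∀

∑-all-or-nothing-% : ∀ {T} d .{{_ : NonZero d}} (s c : Fin T → ℕ) →
  (∀ i → d ≤ s i) → (∀ i → c i ≡ 0 ⊎ c i ≡ s i) →
  T * d + (∑[ i < T ] c i) % d ≤ ∑[ i < T ] s i
∑-all-or-nothing-% {T} d s c large choice
  with q , e , ∑c≡ , Td+e≤∑s ← ∑-all-or-nothing d s c large choice = begin
  T * d + (∑[ i < T ] c i) % d   ≡⟨ cong (λ x → T * d + x % d) ∑c≡ ⟩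
  T * d + (e + q * d) % d        ≡⟨ cong (T * d +_) ([m+kn]%n≡m%n e q d) ⟩
  T * d + e % d                  ≤⟨ +-monoʳ-≤ (T * d) (m%n≤m e d) ⟩
  T * d + e                      ≤⟨ Td+e≤∑s ⟩
  ∑[ i < T ] s i                 ∎
  where open ≤-Reasoning

K-adj-across : ∀ m {u v} → part m u ≢ part m v → K-adj m u v ≡ true
K-adj-across m {u} {v} u≁v with part m u ≟ part m v
... | yes u∼v = ⊥-elim (u≁v u∼v)
... | no _    = refl

module _ (m : ℕ) {t : ℕ} (f : Fin (3 * m) → Fin t) (i : Fin t) (p : Fin 3) where

  Inside Outside : Fin (3 * m) → Set
  Inside  x = f x ≡ i × part m x ≡ p
  Outside x = f x ≡ i × part m x ≢ p

  monochromatic-square : ∀ {a a′ b b′} → a ≢ a′ → b ≢ b′ →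
    Inside a → Inside a′ → Outside b → Outside b′ → MonoCycle (K3 m) f i
  monochromatic-square {a} {a′} {b} {b′} a≢a′ b≢b′ (fa , pa) (fa′ , pa′) (fb , pb) (fb′ , pb′) = record
    { l        = 3
    ; long     = s≤s (s≤s z≤n)
    ; c        = Vec.lookup corners
    ; distinct = λ {x} {y} → VecUnique.lookup-injective corners-unique x y
    ; inClass  = λ { zero → fa ; (suc zero) → fb ; (suc (suc zero)) → fa′ ; (suc (suc (suc zero))) → fb′ }
    ; step     = λ { zero → adjacent pa pb
                   ; (suc zero) → trans (K-sym m b a′) (adjacent pa′ pb)
                   ; (suc (suc zero)) → adjacent pa′ pb′ }
    ; close    = trans (K-sym m b′ a) (adjacent pa pb′)
    }
    where
    corners : Vec (Fin (3 * m)) 4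
    corners = a ∷ b ∷ a′ ∷ b′ ∷ []

    across : ∀ {x y} → part m x ≡ p → part m y ≢ p → part m x ≢ part m y
    across px py x∼y = py (trans (sym x∼y) px)

    adjacent : ∀ {x y} → part m x ≡ p → part m y ≢ p → K-adj m x y ≡ true
    adjacent px py = K-adj-across m (across px py)

    distinct : ∀ {x y} → part m x ≡ p → part m y ≢ p → x ≢ y
    distinct px py x≡y = across px py (cong (part m) x≡y)

    corners-unique : VecUnique.Unique corners
    corners-unique = (distinct pa pb VecAll.∷ a≢a′ VecAll.∷ distinct pa pb′ VecAll.∷ VecAll.[])
                   VecPairs.∷ ((λ b≡a′ → distinct pa′ pb (sym b≡a′)) VecAll.∷ b≢b′ VecAll.∷ VecAll.[])
                   VecPairs.∷ (distinct pa′ pb′ VecAll.∷ VecAll.[])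
                   VecPairs.∷ VecAll.[]
                   VecPairs.∷ VecPairs.[]

∈-class⇒colour : ∀ G {t} (f : Fin (n G) → Fin t) {i v} → v ∈ class G f i → f v ≡ i
∈-class⇒colour G f = proj₂ ∘ ∈-filter⁻ (λ w → f w ≟ _) {xs = allFin (n G)}

module _ {m t k : ℕ} (f : Fin (3 * m) → Fin t) (tree : IsTreeColoring (K3 m) f k) where

  length-filter-class-≤-degree : ∀ {q} {Q : Pred (Fin (3 * m)) q} (Q? : Decidable Q) {i} v → f v ≡ i →
    (∀ {w} → Q w → K-adj m v w ≡ true) → length (filter Q? (class (K3 m) f i)) ≤ k
  length-filter-class-≤-degree Q? {i} v refl Q⇒adj = ≤-trans
    (length-mono-≤ (filter⁺ Q? (λ w → K-adj m v w Bool.≟ true) (λ { refl → Q⇒adj })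
                            (⊆-refl {x = class (K3 m) f i})))
    (proj₂ tree v)

  module _ {u v} (fu≡fv : f u ≡ f v) (u≁v : part m u ≢ part m v) where
    private
      L = class (K3 m) f (f u)
      same? = λ w → part m w ≟ part m u
      A = filter same? L
      B = filter (¬? ∘ same?) L

      L-unique : Unique L
      L-unique = Unique.filter⁺ (λ w → f w ≟ f u) (Unique.allFin⁺ (3 * m))

      |A|≤k : length A ≤ k
      |A|≤k = length-filter-class-≤-degree same? v (sym fu≡fv)
        (λ w∼u → K-adj-across m (λ v∼w → u≁v (trans (sym w∼u) (sym v∼w))))

      |B|≤k : length B ≤ k
      |B|≤k = length-filter-class-≤-degree (¬? ∘ same?) u refl (λ w≁u → K-adj-across m (w≁u ∘ sym))

      inside : ∀ {x} → x ∈ A → Inside m f (f u) (part m u) x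
      inside x∈A = let x∈L , x∼u = ∈-filter⁻ same? x∈A in ∈-class⇒colour (K3 m) f x∈L , x∼u

      outside : ∀ {x} → x ∈ B → Outside m f (f u) (part m u) x
      outside x∈B = let x∈L , x≁u = ∈-filter⁻ (¬? ∘ same?) x∈B in ∈-class⇒colour (K3 m) f x∈L , x≁u

      A-or-B-≤1 : length A ≤ 1 ⊎ length B ≤ 1
      A-or-B-≤1 with length A ≤? 1 | length B ≤? 1
      ... | yes |A|≤1 | _        = inj₁ |A|≤1
      ... | no _     | yes |B|≤1 = inj₂ |B|≤1
      ... | no |A|≰1 | no |B|≰1
        with a , a′ , a≢a′ , a∈A , a′∈A ← distinct-pair (Unique.filter⁺ same? L-unique) (≰⇒> |A|≰1)
           | b , b′ , b≢b′ , b∈B , b′∈B ← distinct-pair (Unique.filter⁺ (¬? ∘ same?) L-unique) (≰⇒> |B|≰1)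
        = ⊥-elim (proj₁ tree (f u) (monochromatic-square m f (f u) (part m u) a≢a′ b≢b′
                                      (inside a∈A) (inside a′∈A) (outside b∈B) (outside b′∈B)))

    classSize-≤-if-two-parts : classSize (K3 m) f (f u) ≤ suc k
    classSize-≤-if-two-parts = begin
      length L               ≡⟨ length-filter+length-filter-¬ same? L ⟨
      length A + length B    ≤⟨ bound A-or-B-≤1 ⟩
      suc k                  ∎
      where
      open ≤-Reasoning
      bound : length A ≤ 1 ⊎ length B ≤ 1 → length A + length B ≤ suc k
      bound (inj₁ |A|≤1) = +-mono-≤ |A|≤1 |B|≤k
      bound (inj₂ |B|≤1) = ≤-trans (+-mono-≤ |A|≤k |B|≤1) (≤-reflexive (+-comm k 1))

  part-constant-on-large-classes : (∀ i → suc (suc k) ≤ classSize (K3 m) f i) →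
    ∀ {u v} → f u ≡ f v → part m u ≡ part m v
  part-constant-on-large-classes large {u} {v} fu≡fv = decidable-stable (part m u ≟ part m v)
    λ u≁v → <⇒≱ (s≤s (classSize-≤-if-two-parts fu≡fv u≁v)) (large (f u))

no-equitable-tree-coloring : ∀ m T k r → T * (2 + k) + r ≡ 3 * m → r < m % (2 + k) →
  ¬ HasEqTreeColoring (K3 m) T k
no-equitable-tree-coloring m T k r 3m≡Td+r r<m%d (f , tree , equitable) = <⇒≱ r<m%d m%d≤r
  where
  d = 2 + k
  s = classSize (K3 m) f
  c : Fin T → ℕ
  c i = length (filter (λ v → part m v ≟ zero) (class (K3 m) f i))

  ∑s≡3m : ∑[ i < T ] s i ≡ 3 * m
  ∑s≡3m = begin
    ∑[ i < T ] s i
      ≡⟨ sum-cong-≗ {T} (λ i → cong length (filter-U? (class (K3 m) f i))) ⟨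
    ∑[ i < T ] length (filter U? (class (K3 m) f i))  ≡⟨ ∑-length-filter-fibres U? f (allFin (3 * m)) ⟩
    length (filter U? (allFin (3 * m)))               ≡⟨ cong length (filter-U? (allFin (3 * m))) ⟩
    length (allFin (3 * m))                           ≡⟨ length-tabulate (λ v → v) ⟩
    3 * m                                             ∎
    where
    open ≡-Reasoning
    filter-U? : ∀ xs → filter U? xs ≡ xs
    filter-U? xs = filter-all U? (universal-U xs)

  large : ∀ i → d ≤ s i
  large = equitable⇒≥ d s equitable (subst (T * d ≤_) (trans 3m≡Td+r (sym ∑s≡3m)) (m≤m+n (T * d) r))

  c-none-or-all : ∀ i → c i ≡ 0 ⊎ c i ≡ s i
  c-none-or-all i = length-filter-none-or-all _ (class (K3 m) f i) λ x∈ y∈ x₀ →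
    trans (part-constant-on-large-classes {m = m} f tree large
            (trans (∈-class⇒colour (K3 m) f y∈) (sym (∈-class⇒colour (K3 m) f x∈)))) x₀

  ∑c≡m : ∑[ i < T ] c i ≡ m
  ∑c≡m = trans (∑-length-filter-fibres _ f (allFin (3 * m))) (length-part₀ m)

  m%d≤r : m % d ≤ r
  m%d≤r = +-cancelˡ-≤ (T * d) _ _ (begin
    T * d + m % d                 ≡⟨ cong (λ x → T * d + x % d) ∑c≡m ⟨
    T * d + (∑[ i < T ] c i) % d  ≤⟨ ∑-all-or-nothing-% d s c large c-none-or-all ⟩
    ∑[ i < T ] s i                ≡⟨ ∑s≡3m ⟩
    3 * m                         ≡⟨ 3m≡Td+r ⟨
    T * d + r                     ∎)
    where open ≤-Reasoning

lower-bound-for-1+5q : ∀ q t → AllAbove (K3 (4 * (1 + q * 5))) 3 t → 12 * (1 + q * 5) + 3 ≤ 5 * t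
lower-bound-for-1+5q q t allAbove = ≮⇒≥ λ 5t<12k+3 →
  no-equitable-tree-coloring m T 3 2 (size q) 2<m%5 (allAbove T (t≤T 5t<12k+3))
  where
  m = 4 * (1 + q * 5)
  T = 12 * q + 2

  size : ∀ q → (12 * q + 2) * 5 + 2 ≡ 3 * (4 * (1 + q * 5))
  size = solve-∀
  m-expand : ∀ q → 4 * (1 + q * 5) ≡ 4 + 4 * q * 5
  m-expand = solve-∀
  bound-expand : ∀ q → 12 * (1 + q * 5) + 3 ≡ 5 * suc (12 * q + 2)
  bound-expand = solve-∀

  2<m%5 : 2 < m % 5
  2<m%5 = subst (2 <_) (sym (trans (cong (_% 5) (m-expand q)) ([m+kn]%n≡m%n 4 (4 * q) 5)))
                (s≤s (s≤s (s≤s z≤n)))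

  t≤T : 5 * t < 12 * (1 + q * 5) + 3 → t ≤ T
  t≤T 5t<12k+3 = ≤-pred (*-cancelˡ-< 5 t (suc T) (subst (5 * t <_) (bound-expand q) 5t<12k+3))

lemma1 : (k : ℕ) → .{{_ : NonZero k}} → k % 5 ≡ 1 → (t : ℕ) →
    IsStrongEqVertexArboricity (K3 (4 * k)) 3 t → 12 * k + 3 ≤ 5 * t
lemma1 k k%5≡1 t (allAbove , _) =
  subst (λ k → AllAbove (K3 (4 * k)) 3 t → 12 * k + 3 ≤ 5 * t) (sym k≡1+q*5)
        (lower-bound-for-1+5q q t) allAbove
  where
  q = k / 5
  k≡1+q*5 : k ≡ 1 + q * 5
  k≡1+q*5 = trans (m≡m%n+[m/n]*n k 5) (cong (_+ q * 5) k%5≡1)
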